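{- Let $n \geq 3$ and let $T, T' \in \mathcal{Y}_n$. If the sets of $1$-minors of $T$ and $T'$ are equal, then $T$ and $T'$ have the same shape. (That is, the set of $1$-minors of a standard Young tableau with $n \geq 3$ entries determines the shape of the tableau.)
   Context: A partition $\lambda$ of $n$ is a non-increasing finite sequence $(\lambda_1,\ldots,\lambda_m)$ of positive integers summing to $n$; its Young diagram is a left-aligned array of cells with $\lambda_h$ cells in row $h$ (rows counted from the top). A standard Young tableau of shape $\lambda$ is a filling of the Young diagram of $\lambda$ with $1,\ldots,n$, each exactly once, increasing left to right along rows and top to bottom down columns; $\mathcal{Y}_n$ denotes the set of standard Young tableaux with $n$ entries. For $T \in \mathcal{Y}_n$ and $m \in \{1,\ldots,n\}$, the tableau $T - m \in \mathcal{Y}_{n-1}$ is obtained as follows: remove the cell containing $m$, leaving a space; repeatedly, let $R$ be the cell immediately right of the space and $B$ the cell immediately below it (if they exist); if $R$ exists and ($B$ does not exist or the entry of $R$ is smaller than that of $B$), slide $R$ into the space; otherwise, if $B$ exists, slide $B$ into the space; if neither exists, stop (jeu de taquin). Finally renumber every entry $p > m$ as $p-1$. The set of $1$-minors of $T$ is $\{T - m : 1 \leq m \leq n\}$. -}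

module Defs where

open import Data.Nat using (ℕ; zero; suc; _<_; _<ᵇ_; _∸_; _+_; _≡ᵇ_)
open import Data.Bool using (Bool; true; false; if_then_else_)
open import Data.Maybe using (Maybe; just; nothing)
open import Data.Product using (_×_; _,_; ∃; ∃-syntax; Σ)
open import Data.List using (List; []; _∷_; length; map; concat; applyUpTo)
open import Data.Nat.ListAction using (sum)
open import Data.List.Relation.Unary.All using (All)
open import Data.List.Relation.Binary.Permutation.Propositional using (_↭_)
open import Relation.Binary.PropositionalEquality using (_≡_)
open import Function.Bundles using (_⇔_)

-- A tableau is a list of rows (top to bottom), each row a list of entries (left to right).
Tableau : Set
Tableau = List (List ℕ)

shape : Tableau → List ℕ
shape T = map length T

-- entry in row r, column c (0-indexed), if the cell exists
at : Tableau → ℕ → ℕ → Maybe ℕ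
at [] r c = nothing
at (row ∷ T) zero c = lookupL row c
  where
  lookupL : List ℕ → ℕ → Maybe ℕ
  lookupL [] _ = nothing
  lookupL (x ∷ xs) zero = just x
  lookupL (x ∷ xs) (suc k) = lookupL xs k
at (row ∷ T) (suc r) c = at T r c

record IsSYT (n : ℕ) (T : Tableau) : Set where
  field
    rowsNonempty : All (λ row → 0 < length row) T
    rowIncreasing : ∀ r c x y → at T r c ≡ just x → at T r (suc c) ≡ just y → x < y
    -- every cell not in the top row has a cell above it with a smaller entry
    -- (this gives left-justified rows of weakly decreasing length and increasing columns)
    colIncreasing : ∀ r c y → at T (suc r) c ≡ just y → ∃[ x ] (at T r c ≡ just x × x < y)
    entries : concat T ↭ applyUpTo suc n

setL : List ℕ → ℕ → ℕ → List ℕ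
setL [] _ _ = []
setL (x ∷ xs) zero v = v ∷ xs
setL (x ∷ xs) (suc k) v = x ∷ setL xs k v

delL : List ℕ → ℕ → List ℕ
delL [] _ = []
delL (x ∷ xs) zero = xs
delL (x ∷ xs) (suc k) = x ∷ delL xs k

setT : Tableau → ℕ → ℕ → ℕ → Tableau
setT [] _ _ _ = []
setT (row ∷ T) zero c v = setL row c v ∷ T
setT (row ∷ T) (suc r) c v = row ∷ setT T r c v

delT : Tableau → ℕ → ℕ → Tableau
delT [] _ _ = []
delT (row ∷ T) zero c with delL row c
... | [] = T
... | row' ∷ rest = (row' ∷ rest) ∷ T
delT (row ∷ T) (suc r) c = row ∷ delT T r c

findRow : ℕ → ℕ → List ℕ → Maybe ℕ
findRow m c [] = nothing
findRow m c (x ∷ xs) = if x ≡ᵇ m then just c else findRow m (suc c) xs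

findT : ℕ → ℕ → Tableau → Maybe (ℕ × ℕ)
findT m r [] = nothing
findT m r (row ∷ T) with findRow m 0 row
... | just c = just (r , c)
... | nothing = findT m (suc r) T

-- jeu de taquin slide of the space at (r,c), with fuel (the number of cells
-- suffices for every valid tableau, since each step moves the space down or right)
slide : ℕ → Tableau → ℕ → ℕ → Tableau
slide zero T r c = T
slide (suc fuel) T r c with at T r (suc c) | at T (suc r) c
... | just x | nothing = slide fuel (setT T r c x) r (suc c)
... | just x | just y =
  if x <ᵇ y then slide fuel (setT T r c x) r (suc c)
            else slide fuel (setT T r c y) (suc r) c
... | nothing | just y = slide fuel (setT T r c y) (suc r) c
... | nothing | nothing = delT T r c

size : Tableau → ℕ
size T = sum (map length T)

renumber : ℕ → Tableau → Tableau
renumber m = map (map (λ p → if m <ᵇ p then p ∸ 1 else p))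

_minus_ : Tableau → ℕ → Tableau
T minus m with findT m 0 T
... | nothing = T
... | just (r , c) = renumber m (slide (suc (size T)) T r c)

IsOneMinor : ℕ → Tableau → Tableau → Set
IsOneMinor n T S = ∃[ m ] (1 Data.Nat.≤ m × m Data.Nat.≤ n × S ≡ T minus m)

-- The 1-minor obtained by deleting the entry of the last cell of a corner row
-- involves no sliding, so its shape is the shape λ of T with that corner removed;
-- every 1-minor of T′ has shape λ′ with some cell removed, as it has fewer cells
-- than T′ and jeu de taquin removes at most one. Equal sets of minors therefore
-- mean that every corner removal of λ is a cell removal of λ′ and vice versa.
-- If λ has two corners, each row of λ survives one of the two removals, so
-- λ ≤ λ′ row by row and equal sizes force λ = λ′. Otherwise λ and λ′ are
-- rectangles, and comparing first rows after removing the corner settles it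
-- once n ≥ 3 (the shapes (2) and (1,1) have the same minor).
module Submission where

open import Defs
open import Data.Nat
open import Data.Nat.Properties
import Data.Bool as Bool
open import Data.Bool using (true; false)
open import Data.Unit using (tt)
open import Data.Maybe using (Maybe; just; nothing)
open import Data.List using (List; []; _∷_; length; concat; _++_; replicate)
open import Data.List.Properties using (length-++; length-map; length-applyUpTo)
open import Data.Nat.ListAction using (sum)
open import Data.List.Relation.Unary.All as All using (All; []; _∷_)
open import Data.List.Relation.Unary.All.Properties using (++⁻ˡ)
open import Data.List.Relation.Unary.Any using (here; there)
open import Data.List.Relation.Unary.AllPairs using ([]; _∷_)
open import Data.List.Relation.Unary.Unique.Propositional using (Unique)
open import Data.List.Relation.Unary.Unique.Propositional.Properties using (applyUpTo⁺₁)
open import Data.List.Membership.Propositional using (_∈_)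
open import Data.List.Membership.Propositional.Properties using (∈-applyUpTo⁻; ∈-++⁺ˡ; ∈-++⁺ʳ)
open import Data.List.Relation.Binary.Permutation.Propositional using (↭-sym; ↭⇒↭ₛ)
open import Data.List.Relation.Binary.Permutation.Propositional.Properties using (∈-resp-↭; ↭-length)
open import Data.Product using (_×_; _,_; proj₁; proj₂; ∃-syntax; Σ-syntax)
open import Data.Sum using (_⊎_; inj₁; inj₂)
open import Data.Empty using (⊥; ⊥-elim)
open import Relation.Nullary using (yes; no)
open import Relation.Binary.PropositionalEquality
open import Data.List.Relation.Binary.Permutation.Setoid.Properties (setoid ℕ) using (Unique-resp-↭)
open import Function.Base using (_∘_)
open import Function.Bundles using (_⇔_; Equivalence)

-- Shapes and their corners

-- Rows beyond the last have length 0.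
part : List ℕ → ℕ → ℕ
part [] _ = 0
part (x ∷ L) zero = x
part (x ∷ L) (suc i) = part L i

shrinkRow : List ℕ → ℕ → List ℕ
shrinkRow [] _ = []
shrinkRow (a ∷ L) (suc r) = a ∷ shrinkRow L r
shrinkRow (suc (suc k) ∷ L) zero = suc k ∷ L
shrinkRow (_ ∷ L) zero = L

IsCorner : List ℕ → ℕ → Set
IsCorner L r = part L (suc r) < part L r

NonIncreasing : List ℕ → Set
NonIncreasing L = ∀ i → part L (suc i) ≤ part L i

record IsPartition (L : List ℕ) : Set where
  field
    positive : All (0 <_) L
    nonIncreasing : NonIncreasing L

positive∧part₀≡0⇒[] : ∀ {L} → All (0 <_) L → part L 0 ≡ 0 → L ≡ []
positive∧part₀≡0⇒[] {[]} _ _ = refl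
positive∧part₀≡0⇒[] {x ∷ L} (x>0 ∷ _) x≡0 = ⊥-elim (<⇒≢ x>0 (sym x≡0))

part-shrinkRow-≢ : ∀ L r i → All (0 <_) L → IsCorner L r → i ≢ r →
                   part (shrinkRow L r) i ≡ part L i
part-shrinkRow-≢ [] r i _ () _
part-shrinkRow-≢ (zero ∷ L) zero i (() ∷ _) _ _
part-shrinkRow-≢ (suc zero ∷ L) zero zero _ _ i≢r = ⊥-elim (i≢r refl)
part-shrinkRow-≢ (suc zero ∷ L) zero (suc i) (_ ∷ pos) corner _
  with positive∧part₀≡0⇒[] pos (n<1⇒n≡0 corner)
... | refl = refl
part-shrinkRow-≢ (suc (suc k) ∷ L) zero zero _ _ i≢r = ⊥-elim (i≢r refl)
part-shrinkRow-≢ (suc (suc k) ∷ L) zero (suc i) _ _ _ = refl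
part-shrinkRow-≢ (a ∷ L) (suc r) zero _ _ _ = refl
part-shrinkRow-≢ (a ∷ L) (suc r) (suc i) (_ ∷ pos) corner i≢r =
  part-shrinkRow-≢ L r i pos corner (i≢r ∘ cong suc)

part-shrinkRow-≤ : ∀ L r i → NonIncreasing L → part (shrinkRow L r) i ≤ part L i
part-shrinkRow-≤ [] r i _ = z≤n
part-shrinkRow-≤ (zero ∷ L) zero i nonIncr = nonIncr i
part-shrinkRow-≤ (suc zero ∷ L) zero i nonIncr = nonIncr i
part-shrinkRow-≤ (suc (suc k) ∷ L) zero zero _ = n≤1+n (suc k)
part-shrinkRow-≤ (suc (suc k) ∷ L) zero (suc i) _ = ≤-refl
part-shrinkRow-≤ (a ∷ L) (suc r) zero _ = ≤-refl
part-shrinkRow-≤ (a ∷ L) (suc r) (suc i) nonIncr = part-shrinkRow-≤ L r i (nonIncr ∘ suc)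

suc-sum-shrinkRow : ∀ L r → 0 < part L r → suc (sum (shrinkRow L r)) ≡ sum L
suc-sum-shrinkRow [] r ()
suc-sum-shrinkRow (suc zero ∷ L) zero _ = refl
suc-sum-shrinkRow (suc (suc k) ∷ L) zero _ = refl
suc-sum-shrinkRow (a ∷ L) (suc r) 0<part =
  trans (sym (+-suc a _)) (cong (a +_) (suc-sum-shrinkRow L r 0<part))

sum-mono-part : ∀ L L′ → All (0 <_) L → (∀ i → part L i ≤ part L′ i) → sum L ≤ sum L′
sum-mono-part [] L′ _ _ = z≤n
sum-mono-part (a ∷ L) [] (a>0 ∷ _) le = ⊥-elim (<⇒≱ a>0 (le 0))
sum-mono-part (a ∷ L) (b ∷ L′) (_ ∷ pos) le =
  +-mono-≤ (le 0) (sum-mono-part L L′ pos (λ i → le (suc i)))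

part-≤∧sum-≡⇒≡ : ∀ L L′ → All (0 <_) L → All (0 <_) L′ →
                 (∀ i → part L i ≤ part L′ i) → sum L ≡ sum L′ → L ≡ L′
part-≤∧sum-≡⇒≡ [] [] _ _ _ _ = refl
part-≤∧sum-≡⇒≡ [] (b ∷ L′) _ (b>0 ∷ _) _ eq =
  ⊥-elim (<⇒≱ b>0 (≤-trans (m≤m+n b (sum L′)) (≤-reflexive (sym eq))))
part-≤∧sum-≡⇒≡ (a ∷ L) [] (a>0 ∷ _) _ le _ = ⊥-elim (<⇒≱ a>0 (le 0))
part-≤∧sum-≡⇒≡ (a ∷ L) (b ∷ L′) (_ ∷ pos) (_ ∷ pos′) le eq =
  cong₂ _∷_ a≡b (part-≤∧sum-≡⇒≡ L L′ pos pos′ (λ i → le (suc i)) tail-sums)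
  where
  b≤a : b ≤ a
  b≤a = +-cancelʳ-≤ (sum L′) b a
          (≤-trans (≤-reflexive (sym eq)) (+-monoʳ-≤ a (sum-mono-part L L′ pos (λ i → le (suc i)))))
  a≡b : a ≡ b
  a≡b = ≤-antisym (le 0) b≤a
  tail-sums : sum L ≡ sum L′
  tail-sums = +-cancelˡ-≡ a _ _ (trans eq (cong (_+ sum L′) (sym a≡b)))

rectangle : ℕ → ℕ → List ℕ
rectangle k w = replicate (suc k) (suc w)

part-rectangle-last : ∀ k w → part (rectangle k w) k ≡ suc w
part-rectangle-last zero w = refl
part-rectangle-last (suc k) w = part-rectangle-last k w

part-rectangle-below : ∀ k w → part (rectangle k w) (suc k) ≡ 0
part-rectangle-below zero w = refl
part-rectangle-below (suc k) w = part-rectangle-below k w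

rectangle-corner : ∀ k w → IsCorner (rectangle k w) k
rectangle-corner k w rewrite part-rectangle-below k w | part-rectangle-last k w = s≤s z≤n

replicate-nonIncreasing : ∀ m v → NonIncreasing (replicate m v)
replicate-nonIncreasing zero v i = z≤n
replicate-nonIncreasing (suc zero) v zero = z≤n
replicate-nonIncreasing (suc (suc m)) v zero = ≤-refl
replicate-nonIncreasing (suc m) v (suc i) = replicate-nonIncreasing m v i

sum-replicate : ∀ m v → sum (replicate m v) ≡ m * v
sum-replicate zero v = refl
sum-replicate (suc m) v = cong (v +_) (sum-replicate m v)

TwoCorners : List ℕ → Set
TwoCorners L = Σ[ r ∈ ℕ ] Σ[ s ∈ ℕ ] r ≢ s × IsCorner L r × IsCorner L s

twoCorners⊎rectangle : ∀ a L → All (0 <_) (a ∷ L) → NonIncreasing (a ∷ L) →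
                       TwoCorners (a ∷ L) ⊎ Σ[ k ∈ ℕ ] Σ[ w ∈ ℕ ] a ∷ L ≡ rectangle k w
twoCorners⊎rectangle (suc w) [] _ _ = inj₂ (0 , w , refl)
twoCorners⊎rectangle a (b ∷ L) (_ ∷ pos) nonIncr
  with twoCorners⊎rectangle b L pos (nonIncr ∘ suc)
... | inj₁ (r , s , r≢s , corner-r , corner-s) =
  inj₁ (suc r , suc s , r≢s ∘ suc-injective , corner-r , corner-s)
... | inj₂ (k , w , refl) with m≤n⇒m<n∨m≡n (nonIncr 0)
...   | inj₁ b<a = inj₁ (0 , suc k , (λ ()) , b<a , rectangle-corner k w)
...   | inj₂ refl = inj₂ (suc k , w , refl)

CornerShrinksIn : List ℕ → List ℕ → Set
CornerShrinksIn L L′ = ∀ r → IsCorner L r → ∃[ r′ ] shrinkRow L r ≡ shrinkRow L′ r′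

part-shrinkRow-≤-part : ∀ {L L′ r} → CornerShrinksIn L L′ → NonIncreasing L′ → IsCorner L r →
                        ∀ i → part (shrinkRow L r) i ≤ part L′ i
part-shrinkRow-≤-part {L} {L′} {r} shrinks nonIncr′ corner i with shrinks r corner
... | r′ , same =
  ≤-trans (≤-reflexive (cong (λ M → part M i) same)) (part-shrinkRow-≤ L′ r′ i nonIncr′)

-- Row i of L survives the removal of whichever of the two corners is not in row i.
twoCorners-determined : ∀ {L L′} → IsPartition L → IsPartition L′ → TwoCorners L →
                        CornerShrinksIn L L′ → sum L ≡ sum L′ → L ≡ L′
twoCorners-determined {L} {L′} isP isP′ (r , s , r≢s , corner-r , corner-s) shrinks sums =
  part-≤∧sum-≡⇒≡ L L′ (IsPartition.positive isP) (IsPartition.positive isP′) part-≤ sums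
  where
  part-≤-away : ∀ i t → IsCorner L t → i ≢ t → part L i ≤ part L′ i
  part-≤-away i t corner i≢t =
    ≤-trans (≤-reflexive (sym (part-shrinkRow-≢ L t i (IsPartition.positive isP) corner i≢t)))
            (part-shrinkRow-≤-part {L} {L′} shrinks (IsPartition.nonIncreasing isP′) corner i)
  part-≤ : ∀ i → part L i ≤ part L′ i
  part-≤ i with i ≟ r
  ... | no i≢r = part-≤-away i r corner-r i≢r
  ... | yes refl = part-≤-away i s corner-s r≢s

width-bound : ∀ {k w k′ w′} → CornerShrinksIn (rectangle k w) (rectangle k′ w′) →
              part (shrinkRow (rectangle k w) k) 0 ≤ suc w′
width-bound {k} {w} {k′} {w′} shrinks =
  part-shrinkRow-≤-part {rectangle k w} {rectangle k′ w′} shrinks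
    (replicate-nonIncreasing (suc k′) (suc w′)) (rectangle-corner k w) 0

part₀-shrinkRow-row : ∀ w → part (shrinkRow (rectangle 0 w) 0) 0 ≡ w
part₀-shrinkRow-row zero = refl
part₀-shrinkRow-row (suc w) = refl

-- A row of length n ≥ 3 loses a cell and becomes a row of length n - 1, which is
-- wider than half of n; a rectangle with at least two rows has no row that wide.
row-not-shrink-of-tall-rectangle : ∀ w k′ w′ → 3 ≤ sum (rectangle 0 w) →
  sum (rectangle 0 w) ≡ sum (rectangle (suc k′) w′) →
  CornerShrinksIn (rectangle 0 w) (rectangle (suc k′) w′) → ⊥
row-not-shrink-of-tall-rectangle w k′ w′ 3≤n sums shrinks = <⇒≱ 3≤n n≤2
  where
  open ≤-Reasoning
  w≤w′+1 : w ≤ suc w′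
  w≤w′+1 = ≤-trans (≤-reflexive (sym (part₀-shrinkRow-row w))) (width-bound shrinks)
  n≡ : sum (rectangle 0 w) ≡ suc w
  n≡ = +-identityʳ (suc w)
  width≤1 : suc w′ ≤ 1
  width≤1 = +-cancelˡ-≤ (suc w′) (suc w′) 1 (begin
    suc w′ + suc w′            ≡⟨ cong (suc w′ +_) (sym (+-identityʳ (suc w′))) ⟩
    2 * suc w′                 ≤⟨ *-monoˡ-≤ (suc w′) (s≤s (s≤s (z≤n {k′}))) ⟩
    suc (suc k′) * suc w′      ≡⟨ sym (sum-replicate (suc (suc k′)) (suc w′)) ⟩
    sum (rectangle (suc k′) w′) ≡⟨ trans (sym sums) n≡ ⟩
    suc w                      ≤⟨ s≤s w≤w′+1 ⟩
    suc (suc w′)               ≡⟨ +-comm 1 (suc w′) ⟩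
    suc w′ + 1                 ∎)
  n≤2 : sum (rectangle 0 w) ≤ 2
  n≤2 = ≤-trans (≤-reflexive n≡) (s≤s (≤-trans w≤w′+1 width≤1))

rectangle-determined : ∀ k w k′ w′ → 3 ≤ sum (rectangle k w) →
  sum (rectangle k w) ≡ sum (rectangle k′ w′) →
  CornerShrinksIn (rectangle k w) (rectangle k′ w′) →
  CornerShrinksIn (rectangle k′ w′) (rectangle k w) → rectangle k w ≡ rectangle k′ w′
rectangle-determined zero w zero w′ _ sums _ _ with +-cancelʳ-≡ 0 (suc w) (suc w′) sums
... | refl = refl
rectangle-determined zero w (suc k′) w′ 3≤n sums shrinks _ =
  ⊥-elim (row-not-shrink-of-tall-rectangle w k′ w′ 3≤n sums shrinks)
rectangle-determined (suc k) w zero w′ 3≤n sums _ shrinks′ =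
  ⊥-elim (row-not-shrink-of-tall-rectangle w′ k w (≤-trans 3≤n (≤-reflexive sums))
            (sym sums) shrinks′)
rectangle-determined (suc k) w (suc k′) w′ _ sums shrinks shrinks′
  with ≤-antisym (width-bound shrinks) (width-bound shrinks′)
... | refl with *-cancelʳ-≡ (suc (suc k)) (suc (suc k′)) (suc w)
                 (trans (sym (sum-replicate (suc (suc k)) (suc w)))
                   (trans sums (sum-replicate (suc (suc k′)) (suc w))))
...   | refl = refl

partition-determined : ∀ {L L′} → IsPartition L → IsPartition L′ → 3 ≤ sum L → sum L ≡ sum L′ →
                       CornerShrinksIn L L′ → CornerShrinksIn L′ L → L ≡ L′
partition-determined {[]} _ _ () _ _ _
partition-determined {a ∷ L} {[]} _ _ 3≤n sums _ _ =
  ⊥-elim (<⇒≢ (≤-trans (s≤s z≤n) 3≤n) (sym sums))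
partition-determined {a ∷ L} {b ∷ L′} isP isP′ 3≤n sums shrinks shrinks′
  with twoCorners⊎rectangle a L (IsPartition.positive isP) (IsPartition.nonIncreasing isP)
     | twoCorners⊎rectangle b L′ (IsPartition.positive isP′) (IsPartition.nonIncreasing isP′)
... | inj₁ two | _ = twoCorners-determined isP isP′ two shrinks sums
... | inj₂ _ | inj₁ two′ = sym (twoCorners-determined isP′ isP two′ shrinks′ (sym sums))
... | inj₂ (k , w , refl) | inj₂ (k′ , w′ , refl) =
  rectangle-determined k w k′ w′ 3≤n sums shrinks shrinks′

-- Cells of a tableau

lookupRow : List ℕ → ℕ → Maybe ℕ
lookupRow [] _ = nothing
lookupRow (x ∷ xs) zero = just x
lookupRow (x ∷ xs) (suc c) = lookupRow xs c

at-zero : ∀ row T c → at (row ∷ T) zero c ≡ lookupRow row c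
at-zero [] T c = refl
at-zero (x ∷ row) T zero = refl
at-zero (x ∷ row) T (suc c) = at-zero row T c

lookupRow-just⇒< : ∀ R c {x} → lookupRow R c ≡ just x → c < length R
lookupRow-just⇒< [] c ()
lookupRow-just⇒< (y ∷ R) zero _ = s≤s z≤n
lookupRow-just⇒< (y ∷ R) (suc c) found = s≤s (lookupRow-just⇒< R c found)

lookupRow-≥ : ∀ R c → length R ≤ c → lookupRow R c ≡ nothing
lookupRow-≥ [] c _ = refl
lookupRow-≥ (y ∷ R) (suc c) (s≤s len≤c) = lookupRow-≥ R c len≤c

lookupRow-< : ∀ R c → c < length R → ∃[ x ] lookupRow R c ≡ just x
lookupRow-< (y ∷ R) zero _ = y , refl
lookupRow-< (y ∷ R) (suc c) (s≤s c<len) = lookupRow-< R c c<len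

lookupRow-∈ : ∀ R c {x} → lookupRow R c ≡ just x → x ∈ R
lookupRow-∈ [] c ()
lookupRow-∈ (y ∷ R) zero refl = here refl
lookupRow-∈ (y ∷ R) (suc c) found = there (lookupRow-∈ R c found)

lookupRow-injective : ∀ R i j {x} → Unique R → lookupRow R i ≡ just x → lookupRow R j ≡ just x → i ≡ j
lookupRow-injective [] i j _ ()
lookupRow-injective (y ∷ R) zero zero _ _ _ = refl
lookupRow-injective (y ∷ R) zero (suc j) (y∉R ∷ _) refl found =
  ⊥-elim (All.lookup y∉R (lookupRow-∈ R j found) refl)
lookupRow-injective (y ∷ R) (suc i) zero (y∉R ∷ _) found refl =
  ⊥-elim (All.lookup y∉R (lookupRow-∈ R i found) refl)
lookupRow-injective (y ∷ R) (suc i) (suc j) (_ ∷ unique) found found′ =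
  cong suc (lookupRow-injective R i j unique found found′)

at-just⇒< : ∀ T r c {x} → at T r c ≡ just x → c < part (shape T) r
at-just⇒< [] r c ()
at-just⇒< (row ∷ T) zero c found = lookupRow-just⇒< row c (trans (sym (at-zero row T c)) found)
at-just⇒< (row ∷ T) (suc r) c found = at-just⇒< T r c found

at-≥ : ∀ T r c → part (shape T) r ≤ c → at T r c ≡ nothing
at-≥ [] r c _ = refl
at-≥ (row ∷ T) zero c len≤c = trans (at-zero row T c) (lookupRow-≥ row c len≤c)
at-≥ (row ∷ T) (suc r) c len≤c = at-≥ T r c len≤c

at-< : ∀ T r c → c < part (shape T) r → ∃[ x ] at T r c ≡ just x
at-< [] r c ()
at-< (row ∷ T) zero c c<len with lookupRow-< row c c<len
... | x , found = x , trans (at-zero row T c) found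
at-< (row ∷ T) (suc r) c c<len = at-< T r c c<len

Unique-++⁻ˡ : ∀ xs {ys : List ℕ} → Unique (xs ++ ys) → Unique xs
Unique-++⁻ˡ [] _ = []
Unique-++⁻ˡ (x ∷ xs) (x∉ ∷ unique) = ++⁻ˡ xs x∉ ∷ Unique-++⁻ˡ xs unique

Unique-++⁻ʳ : ∀ xs {ys : List ℕ} → Unique (xs ++ ys) → Unique ys
Unique-++⁻ʳ [] unique = unique
Unique-++⁻ʳ (x ∷ xs) (_ ∷ unique) = Unique-++⁻ʳ xs unique

Unique-++-disjoint : ∀ xs {ys : List ℕ} {z} → Unique (xs ++ ys) → z ∈ xs → z ∈ ys → ⊥
Unique-++-disjoint (x ∷ xs) (x∉ ∷ _) (here refl) z∈ys = All.lookup x∉ (∈-++⁺ʳ xs z∈ys) refl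
Unique-++-disjoint (x ∷ xs) (_ ∷ unique) (there z∈xs) z∈ys = Unique-++-disjoint xs unique z∈xs z∈ys

at-∈ : ∀ T r c {x} → at T r c ≡ just x → x ∈ concat T
at-∈ [] r c ()
at-∈ (row ∷ T) zero c found = ∈-++⁺ˡ (lookupRow-∈ row c (trans (sym (at-zero row T c)) found))
at-∈ (row ∷ T) (suc r) c found = ∈-++⁺ʳ row (at-∈ T r c found)

at-injective : ∀ T r c r′ c′ {x} → Unique (concat T) →
               at T r c ≡ just x → at T r′ c′ ≡ just x → r ≡ r′ × c ≡ c′
at-injective [] r c r′ c′ _ ()
at-injective (row ∷ T) zero c zero c′ unique found found′ =
  refl , lookupRow-injective row c c′ (Unique-++⁻ˡ row unique)
           (trans (sym (at-zero row T c)) found) (trans (sym (at-zero row T c′)) found′)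
at-injective (row ∷ T) zero c (suc r′) c′ unique found found′ = ⊥-elim
  (Unique-++-disjoint row unique (lookupRow-∈ row c (trans (sym (at-zero row T c)) found))
     (at-∈ T r′ c′ found′))
at-injective (row ∷ T) (suc r) c zero c′ unique found found′ = ⊥-elim
  (Unique-++-disjoint row unique (lookupRow-∈ row c′ (trans (sym (at-zero row T c′)) found′))
     (at-∈ T r c found))
at-injective (row ∷ T) (suc r) c (suc r′) c′ unique found found′
  with at-injective T r c r′ c′ (Unique-++⁻ʳ row unique) found found′
... | refl , refl = refl , refl

-- Shapes of the tableau operations

length-setL : ∀ R c v → length (setL R c v) ≡ length R
length-setL [] c v = refl
length-setL (x ∷ R) zero v = refl
length-setL (x ∷ R) (suc c) v = cong suc (length-setL R c v)

shape-setT : ∀ T r c v → shape (setT T r c v) ≡ shape T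
shape-setT [] r c v = refl
shape-setT (row ∷ T) zero c v = cong (_∷ shape T) (length-setL row c v)
shape-setT (row ∷ T) (suc r) c v = cong (length row ∷_) (shape-setT T r c v)

suc-length-delL : ∀ R c → c < length R → suc (length (delL R c)) ≡ length R
suc-length-delL (x ∷ R) zero _ = refl
suc-length-delL (x ∷ R) (suc c) (s≤s c<len) = cong suc (suc-length-delL R c c<len)

delL-≥ : ∀ R c → length R ≤ c → delL R c ≡ R
delL-≥ [] c _ = refl
delL-≥ (x ∷ R) (suc c) (s≤s len≤c) = cong (x ∷_) (delL-≥ R c len≤c)

shape-delT-top : ∀ R T c → c < length R → shape (delT (R ∷ T) zero c) ≡ shrinkRow (shape (R ∷ T)) zero
shape-delT-top R T c c<len with delL R c | suc-length-delL R c c<len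
... | [] | length≡ rewrite sym length≡ = refl
... | _ ∷ _ | length≡ rewrite sym length≡ = refl

shape-delT : ∀ T r c → c < part (shape T) r → shape (delT T r c) ≡ shrinkRow (shape T) r
shape-delT [] r c ()
shape-delT (row ∷ T) zero c c<len = shape-delT-top row T c c<len
shape-delT (row ∷ T) (suc r) c c<len = cong (length row ∷_) (shape-delT T r c c<len)

ShapeStep : List ℕ → List ℕ → Set
ShapeStep L M = M ≡ L ⊎ ∃[ r ] M ≡ shrinkRow L r

shapeStep-delT : ∀ T r c → ShapeStep (shape T) (shape (delT T r c))
shapeStep-delT [] r c = inj₁ refl
shapeStep-delT (row ∷ T) zero c with c <? length row
... | yes c<len = inj₂ (0 , shape-delT-top row T c c<len)
shapeStep-delT ([] ∷ T) zero c | no _ = inj₂ (0 , refl)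
shapeStep-delT ((x ∷ xs) ∷ T) zero c | no c≮len
  with delL (x ∷ xs) c | delL-≥ (x ∷ xs) c (≮⇒≥ c≮len)
... | _ | refl = inj₁ refl
shapeStep-delT (row ∷ T) (suc r) c with shapeStep-delT T r c
... | inj₁ same = inj₁ (cong (length row ∷_) same)
... | inj₂ (r′ , shrunk) = inj₂ (suc r′ , cong (length row ∷_) shrunk)

shapeStep-setT : ∀ T r c v {M} → ShapeStep (shape (setT T r c v)) M → ShapeStep (shape T) M
shapeStep-setT T r c v {M} = subst (λ L → ShapeStep L M) (shape-setT T r c v)

shapeStep-slide : ∀ fuel T r c → ShapeStep (shape T) (shape (slide fuel T r c))
shapeStep-slide zero T r c = inj₁ refl
shapeStep-slide (suc fuel) T r c with at T r (suc c) | at T (suc r) c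
... | just x | nothing = shapeStep-setT T r c x (shapeStep-slide fuel (setT T r c x) r (suc c))
... | just x | just y with x <ᵇ y
...   | true = shapeStep-setT T r c x (shapeStep-slide fuel (setT T r c x) r (suc c))
...   | false = shapeStep-setT T r c y (shapeStep-slide fuel (setT T r c y) (suc r) c)
shapeStep-slide (suc fuel) T r c | nothing | just y =
  shapeStep-setT T r c y (shapeStep-slide fuel (setT T r c y) (suc r) c)
shapeStep-slide (suc fuel) T r c | nothing | nothing = shapeStep-delT T r c

shape-renumber : ∀ m T → shape (renumber m T) ≡ shape T
shape-renumber m [] = refl
shape-renumber m (row ∷ T) = cong₂ _∷_ (length-map _ row) (shape-renumber m T)

shapeStep-minus : ∀ T m → ShapeStep (shape T) (shape (T minus m))
shapeStep-minus T m with findT m 0 T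
... | nothing = inj₁ refl
... | just (r , c) =
  subst (ShapeStep (shape T)) (sym (shape-renumber m (slide (suc (size T)) T r c)))
        (shapeStep-slide (suc (size T)) T r c)

shape-minus-corner : ∀ T m r c → findT m 0 T ≡ just (r , c) → c < part (shape T) r →
                     at T r (suc c) ≡ nothing → at T (suc r) c ≡ nothing →
                     shape (T minus m) ≡ shrinkRow (shape T) r
shape-minus-corner T m r c found c<len _ _ with findT m 0 T
shape-minus-corner T m r c refl c<len _ _ | _ with at T r (suc c) | at T (suc r) c
shape-minus-corner T m r c refl c<len refl refl | _ | _ | _ =
  trans (shape-renumber m (delT T r c)) (shape-delT T r c c<len)

findRow-sound : ∀ m c₀ R c → findRow m c₀ R ≡ just c → ∃[ k ] c ≡ c₀ + k × lookupRow R k ≡ just m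
findRow-sound m c₀ [] c ()
findRow-sound m c₀ (x ∷ xs) c found with x ≡ᵇ m in x≡ᵇm
... | true with found
...   | refl = 0 , sym (+-identityʳ c₀) , cong just (≡ᵇ⇒≡ x m (subst Bool.T (sym x≡ᵇm) tt))
findRow-sound m c₀ (x ∷ xs) c found | false with findRow-sound m (suc c₀) xs c found
... | k , c≡ , at-k = suc k , trans c≡ (sym (+-suc c₀ k)) , at-k

findRow-complete : ∀ m c₀ R k → lookupRow R k ≡ just m → ∃[ c ] findRow m c₀ R ≡ just c
findRow-complete m c₀ [] k ()
findRow-complete m c₀ (x ∷ xs) k at-k with x ≡ᵇ m in x≡ᵇm
... | true = c₀ , refl
findRow-complete m c₀ (x ∷ xs) zero refl | false = ⊥-elim (subst Bool.T x≡ᵇm (≡⇒≡ᵇ x x refl))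
findRow-complete m c₀ (x ∷ xs) (suc k) at-k | false = findRow-complete m (suc c₀) xs k at-k

findT-sound : ∀ m r₀ T r c → findT m r₀ T ≡ just (r , c) → ∃[ k ] r ≡ r₀ + k × at T k c ≡ just m
findT-sound m r₀ [] r c ()
findT-sound m r₀ (row ∷ T) r c found with findRow m 0 row in inRow
... | just c′ with found
...   | refl with findRow-sound m 0 row c inRow
...     | k , refl , at-k = 0 , sym (+-identityʳ r₀) , trans (at-zero row T k) at-k
findT-sound m r₀ (row ∷ T) r c found | nothing with findT-sound m (suc r₀) T r c found
... | k , r≡ , at-k = suc k , trans r≡ (sym (+-suc r₀ k)) , at-k

findT-complete : ∀ m r₀ T r c → at T r c ≡ just m → ∃[ p ] findT m r₀ T ≡ just p
findT-complete m r₀ [] r c ()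
findT-complete m r₀ (row ∷ T) r c at-rc with findRow m 0 row in inRow
... | just c′ = _ , refl
findT-complete m r₀ (row ∷ T) zero c at-rc | nothing
  with findRow-complete m 0 row c (trans (sym (at-zero row T c)) at-rc)
... | _ , found rewrite inRow with found
... | ()
findT-complete m r₀ (row ∷ T) (suc r) c at-rc | nothing = findT-complete m (suc r₀) T r c at-rc

-- Standard Young tableaux

length-concat : ∀ T → length (concat T) ≡ sum (shape T)
length-concat [] = refl
length-concat (row ∷ T) = trans (length-++ row) (cong (length row +_) (length-concat T))

positive-shape : ∀ {T} → All (λ row → 0 < length row) T → All (0 <_) (shape T)
positive-shape [] = []
positive-shape (row>0 ∷ rows>0) = row>0 ∷ positive-shape rows>0

module _ {n : ℕ} {T : Tableau} (syt : IsSYT n T) where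
  open IsSYT syt

  sum-shape : sum (shape T) ≡ n
  sum-shape = trans (sym (length-concat T)) (trans (↭-length entries) (length-applyUpTo suc n))

  -- A cell under the end of row i would need a cell above it, i.e. in row i.
  shape-isPartition : IsPartition (shape T)
  shape-isPartition = record { positive = positive-shape rowsNonempty ; nonIncreasing = nonIncreasing }
    where
    nonIncreasing : NonIncreasing (shape T)
    nonIncreasing i with part (shape T) (suc i) ≤? part (shape T) i
    ... | yes i+1≤i = i+1≤i
    ... | no i+1≰i with at-< T (suc i) (part (shape T) i) (≰⇒> i+1≰i)
    ...   | y , below with colIncreasing i (part (shape T) i) y below
    ...     | x , above , _ = ⊥-elim (<-irrefl refl (at-just⇒< T i (part (shape T) i) above))

  entries-unique : Unique (concat T)
  entries-unique = Unique-resp-↭ (↭⇒↭ₛ (↭-sym entries))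
    (applyUpTo⁺₁ suc n (λ i<j _ → <⇒≢ i<j ∘ suc-injective))

  entry-bounds : ∀ r c {x} → at T r c ≡ just x → 1 ≤ x × x ≤ n
  entry-bounds r c found with ∈-applyUpTo⁻ suc (∈-resp-↭ entries (at-∈ T r c found))
  ... | i , i<n , refl = s≤s z≤n , i<n

  -- Deleting the entry of a last cell with no cell below needs no sliding at all.
  lastCellMinor-shape : ∀ r c → suc c ≡ part (shape T) r → part (shape T) (suc r) ≤ c →
                        ∃[ m ] 1 ≤ m × m ≤ n × shape (T minus m) ≡ shrinkRow (shape T) r
  lastCellMinor-shape r c c+1≡len nothing-below with at-< T r c (≤-reflexive c+1≡len)
  ... | m , at-m with findT-complete m 0 T r c at-m
  ...   | (r′ , c′) , found with findT-sound m 0 T r′ c′ found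
  ...     | k , refl , at-m′ with at-injective T k c′ r c entries-unique at-m′ at-m
  ...       | refl , refl = m , proj₁ (entry-bounds r c at-m) , proj₂ (entry-bounds r c at-m) ,
    shape-minus-corner T m r c found (≤-reflexive c+1≡len)
      (at-≥ T r (suc c) (≤-reflexive (sym c+1≡len))) (at-≥ T (suc r) c nothing-below)

  cornerMinor-shape : ∀ r → IsCorner (shape T) r →
                      ∃[ m ] 1 ≤ m × m ≤ n × shape (T minus m) ≡ shrinkRow (shape T) r
  cornerMinor-shape r corner =
    lastCellMinor-shape r _ c+1≡len (s≤s⁻¹ (≤-trans corner (≤-reflexive (sym c+1≡len))))
    where
    c+1≡len : suc (pred (part (shape T) r)) ≡ part (shape T) r
    c+1≡len = suc-pred (part (shape T) r) {{>-nonZero (≤-trans (s≤s z≤n) corner)}}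

cornerShrinks-of-minors : ∀ {n T T′} → IsSYT n T → IsSYT n T′ →
  (∀ S → IsOneMinor n T S → IsOneMinor n T′ S) → CornerShrinksIn (shape T) (shape T′)
cornerShrinks-of-minors {n} {T} {T′} syt syt′ minors r corner with cornerMinor-shape syt r corner
... | m , 1≤m , m≤n , shape-minor with minors (T minus m) (m , 1≤m , m≤n , refl)
...   | m′ , _ , _ , same-minor with shapeStep-minus T′ m′
...     | inj₂ (r′ , shrunk) = r′ , trans (sym shape-minor) (trans (cong shape same-minor) shrunk)
-- A minor of T has n - 1 cells, so it cannot have the shape of T′.
...     | inj₁ unchanged = ⊥-elim (1+n≢n (trans (sym (cong suc same-size)) smaller))
  where
  smaller : suc (sum (shrinkRow (shape T) r)) ≡ n
  smaller = trans (suc-sum-shrinkRow (shape T) r (≤-trans (s≤s z≤n) corner)) (sum-shape syt)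
  same-size : sum (shrinkRow (shape T) r) ≡ n
  same-size = trans (cong sum (trans (sym shape-minor) (trans (cong shape same-minor) unchanged)))
                    (sum-shape syt′)

mainTheorem1 : (n : ℕ) → n ≥ 3 → (T T′ : Tableau) → IsSYT n T → IsSYT n T′
    → (∀ (S : Tableau) → IsOneMinor n T S ⇔ IsOneMinor n T′ S)
    → shape T ≡ shape T′
mainTheorem1 n n≥3 T T′ syt syt′ sameMinors =
  partition-determined (shape-isPartition syt) (shape-isPartition syt′)
    (≤-trans n≥3 (≤-reflexive (sym (sum-shape syt))))
    (trans (sum-shape syt) (sym (sum-shape syt′)))
    (cornerShrinks-of-minors syt syt′ (λ S → Equivalence.to (sameMinors S)))
    (cornerShrinks-of-minors syt′ syt (λ S → Equivalence.from (sameMinors S)))
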